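{- For every non-negative integer $n$, \[ \sum_{k=0}^{n} (-1)^{k}\frac{2^{2k}}{2k+1}\frac{\binom{n}{k}}{\binom{2k}{k}} = \frac{1}{2n+1} \qquad\text{and}\qquad \sum_{k=0}^{n} (-1)^{k+1} 2^{2k}\frac{k}{2k+1}\frac{\binom{n}{k}}{\binom{2k}{k}} = \frac{2n}{(2n+1)(2n-1)}. \] -}

module Defs where

open import Data.Nat using (ℕ; zero; suc; _+_; _*_; _^_; _≤_; _<_; z≤n; s≤s; NonZero; >-nonZero)
open import Data.Nat.Properties using (≤-trans; m≤m+n; ≤-refl; m*n≢0; +-comm)
open import Data.Nat.Combinatorics using (_C_; nCk≡nC[n∸k]; nCn≡1; nCk+nC[k+1]≡[n+1]C[k+1])
import Data.Integer.Properties
import Data.Nat.Properties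
open import Data.Integer using (ℤ; +_; -[1+_])
import Data.Rational as ℚ
open ℚ using (ℚ; _/_; 0ℚ)
open import Data.Rational.Literals using (fromℤ)
open import Data.List using (List; map; foldr; upTo)
open import Relation.Binary.PropositionalEquality using (_≡_; refl; sym; trans; subst)

nCk>0 : ∀ n k → k ≤ n → 0 < n C k
nCk>0 n zero _ = subst (0 <_) (sym (trans (nCk≡nC[n∸k] {0} {n} z≤n) (nCn≡1 n))) (s≤s z≤n)
nCk>0 (suc n) (suc k) (s≤s k≤n) =
  subst (0 <_) (nCk+nC[k+1]≡[n+1]C[k+1] n k) (≤-trans (nCk>0 n k k≤n) (m≤m+n _ _))

centralNonZero : ∀ k → NonZero ((2 * k) C k)
centralNonZero k = >-nonZero (nCk>0 (2 * k) k (m≤m+n k (k + 0)))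

denNonZero : ∀ k → NonZero ((2 * k + 1) * ((2 * k) C k))
denNonZero k = m*n≢0 (2 * k + 1) ((2 * k) C k)
  where instance _ : NonZero (2 * k + 1)
                 _ = >-nonZero (subst (0 <_) (+-comm 1 (2 * k)) (s≤s z≤n))
                 _ : NonZero ((2 * k) C k)
                 _ = centralNonZero k

sign : ℕ → ℤ
sign zero = + 1
sign (suc k) = Data.Integer.- sign k

sumTo : ℕ → (ℕ → ℚ) → ℚ
sumTo n f = foldr ℚ._+_ 0ℚ (map f (upTo (suc n)))

term₁ : ℕ → ℕ → ℚ
term₁ n k = _/_ (sign k Data.Integer.* + (2 ^ (2 * k) * (n C k)))
                ((2 * k + 1) * ((2 * k) C k)) {{denNonZero k}}

term₂ : ℕ → ℕ → ℚ
term₂ n k = _/_ (sign (suc k) Data.Integer.* + (2 ^ (2 * k) * k * (n C k)))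
                ((2 * k + 1) * ((2 * k) C k)) {{denNonZero k}}

-- (2n+1)(2n-1) as a rational number (2n-1 taken in ℤ, so it is -1 when n = 0)
den₂ : ℕ → ℚ
den₂ n = fromℤ ((+ (2 * n + 1)) Data.Integer.* ((+ (2 * n)) Data.Integer.- (+ 1)))

den₂NonZero : ∀ n → ℚ.NonZero (den₂ n)
den₂NonZero zero = _
den₂NonZero (suc n) = Data.Integer.Properties.i*j≢0 (+ (2 * suc n + 1)) (+ (2 * suc n) Data.Integer.- + 1) {{_}} {{lem}}
  where
    lem : Data.Integer.NonZero (+ (2 * suc n) Data.Integer.- + 1)
    lem rewrite Data.Nat.Properties.+-suc n (n + 0) = _

rhs₂ : ℕ → ℚ
rhs₂ n = ℚ._÷_ (fromℤ (+ (2 * n))) (den₂ n) {{den₂NonZero n}}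

oddNonZero : ∀ n → ℚ.NonZero (fromℤ (+ (2 * n + 1)))
oddNonZero n rewrite +-comm (2 * n) 1 = _

rhs₁ : ℕ → ℚ
rhs₁ n = ℚ._÷_ (fromℤ (+ 1)) (fromℤ (+ (2 * n + 1))) {{oddNonZero n}}

{-# OPTIONS --safe #-}
module Submission where

-- Write t k = (-4)ᵏ / ((2k+1) C(2k,k)) and u n m = Σₖ C(n,k) t(m+k). The first sum is u n 0, and
-- by the absorption identity (k+1) C(n+1,k+1) = (n+1) C(n,k) the second sum for n+1 is -(n+1) u n 1.
-- The ratio t(m+1) / t m = -(2m+2)/(2m+3) propagates through Pascal's rule
-- u (n+1) m = u n m + u n (m+1) to the pair of recurrences
--   (2n+2m+3) u n (m+1) = -(2m+2) u n m,     (2n+2m+3) u (n+1) m = (2n+1) u n m,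
-- proved by a simultaneous induction on n. Hence (2n+1) u n 0 = 1 and (2n+3) u n 1 = -2 u n 0.

open import Function using (_∘_)
open import Data.Nat as ℕ using (ℕ; zero; suc; _^_)
import Data.Nat.Properties as ℕ
open import Data.Nat.Combinatorics using (_C_; nC1≡n; nCk≡nC[n∸k]; nCk+nC[k+1]≡[n+1]C[k+1])
open import Data.Nat.Combinatorics.Specification using (k>n⇒nCk≡0)
import Data.Nat.Tactic.RingSolver as ℕ-Solver
import Data.Integer as ℤ
import Data.Integer.Properties as ℤ
import Data.Integer.Tactic.RingSolver as ℤ-Solver
open import Data.Rational using (ℚ; _/_; _÷_; 1/_; NonZero; 0ℚ; 1ℚ; toℚᵘ)
open import Data.Rational.Properties
  using ( toℚᵘ-injective; toℚᵘ-fromℚᵘ; toℚᵘ-homo-+; toℚᵘ-homo-*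
        ; +-assoc; +-identityˡ; +-identityʳ; *-assoc; *-comm; *-identityˡ; *-identityʳ
        ; *-zeroˡ; *-zeroʳ; *-inverseˡ; *-inverseʳ; *-distribˡ-+; *-distribʳ-+; *-1-commutativeMonoid )
import Data.Rational.Unnormalised as ℚᵘ
import Data.Rational.Unnormalised.Properties as ℚᵘ
open import Data.Rational.Literals using (fromℤ)
open import Data.Rational.Solver using (module +-*-Solver)
open +-*-Solver using (solve; _:+_; _:*_; :-_; _:=_)
open import Algebra.Bundles using (CommutativeMonoid)
open import Algebra.Properties.CommutativeSemigroup (CommutativeMonoid.commutativeSemigroup *-1-commutativeMonoid)
  using (x∙yz≈y∙xz)
open import Data.List using ([]; _∷_; foldr; map; upTo)
open import Data.List.Properties using (map-cong; map-upTo)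
open import Data.Product using (_×_; _,_)
open import Relation.Binary.PropositionalEquality using (_≡_; refl; sym; trans; cong; cong₂; subst; module ≡-Reasoning)
open ≡-Reasoning

open import Defs

module _ where
  open import Data.Nat.Base using (_+_; _*_)

  [1+k]*[1+n]C[1+k]≡[1+n]*nCk : ∀ n k → suc k * (suc n C suc k) ≡ suc n * (n C k)
  [1+k]*[1+n]C[1+k]≡[1+n]*nCk zero    zero    = refl
  [1+k]*[1+n]C[1+k]≡[1+n]*nCk zero    (suc k) = ℕ.*-zeroʳ (2 + k)
  [1+k]*[1+n]C[1+k]≡[1+n]*nCk (suc n) zero    =
    trans (ℕ.*-identityˡ _) (trans (nC1≡n (2 + n)) (sym (ℕ.*-identityʳ (2 + n))))
  [1+k]*[1+n]C[1+k]≡[1+n]*nCk (suc n) (suc k) = begin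
    (2 + k) * ((2 + n) C (2 + k))                    ≡⟨ cong ((2 + k) *_) (sym (C-pascal (suc n) (suc k))) ⟩
    (2 + k) * (A + B)                                ≡⟨ split k A B ⟩
    (1 + k) * A + A + (2 + k) * B                    ≡⟨ cong₂ (λ x y → x + A + y) ([1+k]*[1+n]C[1+k]≡[1+n]*nCk n k)
                                                                             ([1+k]*[1+n]C[1+k]≡[1+n]*nCk n (suc k)) ⟩
    (1 + n) * (n C k) + A + (1 + n) * (n C suc k)    ≡⟨ regroup n (n C k) (n C suc k) A ⟩
    (1 + n) * (n C k + n C suc k) + A                ≡⟨ cong (λ x → (1 + n) * x + A) (C-pascal n k) ⟩
    (1 + n) * A + A                                  ≡⟨ ℕ.+-comm ((1 + n) * A) A ⟩
    (2 + n) * A                                      ∎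
    where
    C-pascal = nCk+nC[k+1]≡[n+1]C[k+1]
    A = suc n C suc k
    B = suc n C (2 + k)
    split : ∀ k A B → (2 + k) * (A + B) ≡ (1 + k) * A + A + (2 + k) * B
    split = ℕ-Solver.solve-∀
    regroup : ∀ n a b A → (1 + n) * a + A + (1 + n) * b ≡ (1 + n) * (a + b) + A
    regroup = ℕ-Solver.solve-∀

  [m+n]Cm≡[m+n]Cn : ∀ m n → (m + n) C m ≡ (m + n) C n
  [m+n]Cm≡[m+n]Cn m n = trans (nCk≡nC[n∸k] (ℕ.m≤m+n m n)) (cong ((m + n) C_) (ℕ.m+n∸m≡n m n))

  [1+k]*[2+2k]C[1+k]≡2[2k+1]*2kCk : ∀ k → suc k * (2 * suc k C suc k) ≡ 2 * (2 * k + 1) * (2 * k C k)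
  [1+k]*[2+2k]C[1+k]≡2[2k+1]*2kCk k = begin
    suc k * (2 * suc k C suc k)            ≡⟨ cong (λ x → suc k * (x C suc k)) (ℕ.*-suc 2 k) ⟩
    suc k * (suc (suc (2 * k)) C suc k)    ≡⟨ [1+k]*[1+n]C[1+k]≡[1+n]*nCk (suc (2 * k)) k ⟩
    (2 + 2 * k) * (suc (2 * k) C k)        ≡⟨ cong (λ x → (2 + 2 * k) * x) middle ⟩
    (2 + 2 * k) * (suc (2 * k) C suc k)    ≡⟨ factor k (suc (2 * k) C suc k) ⟩
    2 * (suc k * (suc (2 * k) C suc k))    ≡⟨ cong (2 *_) ([1+k]*[1+n]C[1+k]≡[1+n]*nCk (2 * k) k) ⟩
    2 * (suc (2 * k) * (2 * k C k))        ≡⟨ reassoc k (2 * k C k) ⟩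
    2 * (2 * k + 1) * (2 * k C k)          ∎
    where
    factor : ∀ k x → (2 + 2 * k) * x ≡ 2 * (suc k * x)
    factor = ℕ-Solver.solve-∀
    reassoc : ∀ k x → 2 * (suc (2 * k) * x) ≡ 2 * (2 * k + 1) * x
    reassoc = ℕ-Solver.solve-∀
    middle : suc (2 * k) C k ≡ suc (2 * k) C suc k
    middle = subst (λ n → n C k ≡ n C suc k) (lemma k) ([m+n]Cm≡[m+n]Cn k (suc k))
      where lemma : ∀ k → k + suc k ≡ suc (2 * k)
            lemma = ℕ-Solver.solve-∀

  D : ℕ → ℕ
  D k = (2 * k + 1) * (2 * k C k)

  D-suc : ∀ m → (2 + 2 * m) * D (suc m) ≡ 4 * ((3 + 2 * m) * D m)
  D-suc m = begin
    (2 + 2 * m) * D (suc m)                                ≡⟨ regroup m (2 * suc m C suc m) ⟩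
    2 * (2 * suc m + 1) * (suc m * (2 * suc m C suc m))    ≡⟨ cong (2 * (2 * suc m + 1) *_) ([1+k]*[2+2k]C[1+k]≡2[2k+1]*2kCk m) ⟩
    2 * (2 * suc m + 1) * (2 * (2 * m + 1) * (2 * m C m))  ≡⟨ regroup′ m (2 * m C m) ⟩
    4 * ((3 + 2 * m) * D m)                                ∎
    where
    regroup : ∀ m x → (2 + 2 * m) * ((2 * suc m + 1) * x) ≡ 2 * (2 * suc m + 1) * (suc m * x)
    regroup = ℕ-Solver.solve-∀
    regroup′ : ∀ m y → 2 * (2 * suc m + 1) * (2 * (2 * m + 1) * y) ≡ 4 * ((3 + 2 * m) * ((2 * m + 1) * y))
    regroup′ = ℕ-Solver.solve-∀

module _ where
  open import Data.Rational.Base using (_+_; _*_; -_)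

  fromℕ : ℕ → ℚ
  fromℕ n = fromℤ (ℤ.+ n)

  fromℤ-+ : ∀ i j → fromℤ (i ℤ.+ j) ≡ fromℤ i + fromℤ j
  fromℤ-+ i j = toℚᵘ-injective (ℚᵘ.≃-sym (ℚᵘ.≃-trans (toℚᵘ-homo-+ (fromℤ i) (fromℤ j)) (ℚᵘ.*≡* (lemma i j))))
    where lemma : ∀ i j → (i ℤ.* ℤ.+ 1 ℤ.+ j ℤ.* ℤ.+ 1) ℤ.* ℤ.+ 1 ≡ (i ℤ.+ j) ℤ.* ℤ.+ 1
          lemma = ℤ-Solver.solve-∀

  fromℤ-* : ∀ i j → fromℤ (i ℤ.* j) ≡ fromℤ i * fromℤ j
  fromℤ-* i j = toℚᵘ-injective (ℚᵘ.≃-sym (toℚᵘ-homo-* (fromℤ i) (fromℤ j)))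

  fromℤ-neg : ∀ i → fromℤ (ℤ.- i) ≡ - fromℤ i
  fromℤ-neg (ℤ.+ zero)  = refl
  fromℤ-neg (ℤ.+ suc n) = refl
  fromℤ-neg ℤ.-[1+ n ]  = refl

  fromℕ-+ : ∀ m n → fromℕ (m ℕ.+ n) ≡ fromℕ m + fromℕ n
  fromℕ-+ m n = trans (cong fromℤ (ℤ.pos-+ m n)) (fromℤ-+ (ℤ.+ m) (ℤ.+ n))

  fromℕ-* : ∀ m n → fromℕ (m ℕ.* n) ≡ fromℕ m * fromℕ n
  fromℕ-* m n = trans (cong fromℤ (ℤ.pos-* m n)) (fromℤ-* (ℤ.+ m) (ℤ.+ n))

  fromℕq*[p/q]≡p : ∀ p q .{{_ : ℕ.NonZero q}} → fromℕ q * (p / q) ≡ fromℤ p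
  fromℕq*[p/q]≡p p (suc q) = toℚᵘ-injective (ℚᵘ.≃-trans (toℚᵘ-homo-* (fromℕ (suc q)) (p / suc q))
    (ℚᵘ.≃-trans (ℚᵘ.*-congˡ {toℚᵘ (fromℕ (suc q))} (toℚᵘ-fromℚᵘ (ℚᵘ.mkℚᵘ p q))) (ℚᵘ.*≡* (lemma p (ℤ.+ suc q)))))
    where lemma : ∀ p q → q ℤ.* p ℤ.* ℤ.+ 1 ≡ p ℤ.* (ℤ.+ 1 ℤ.* q)
          lemma = ℤ-Solver.solve-∀

  *-cancelˡ-≡ : ∀ r .{{_ : NonZero r}} {p q} → r * p ≡ r * q → p ≡ q
  *-cancelˡ-≡ r {p} {q} rp≡rq = begin
    p                ≡⟨ 1/r*[r*x]≡x p ⟨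
    1/ r * (r * p)   ≡⟨ cong (1/ r *_) rp≡rq ⟩
    1/ r * (r * q)   ≡⟨ 1/r*[r*x]≡x q ⟩
    q                ∎
    where
    1/r*[r*x]≡x : ∀ x → 1/ r * (r * x) ≡ x
    1/r*[r*x]≡x x = trans (sym (*-assoc (1/ r) r x)) (trans (cong (_* x) (*-inverseˡ r)) (*-identityˡ x))

  /-unique : ∀ {x} p q .{{_ : ℕ.NonZero q}} → fromℕ q * x ≡ fromℤ p → p / q ≡ x
  /-unique p q qx≡p = *-cancelˡ-≡ (fromℕ q) (trans (fromℕq*[p/q]≡p p q) (sym qx≡p))

  ÷-unique : ∀ {x y} d .{{_ : NonZero d}} → d * x ≡ y → y ÷ d ≡ x
  ÷-unique {x} {y} d dx≡y = *-cancelˡ-≡ d (begin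
    d * (y * 1/ d)   ≡⟨ cong (d *_) (*-comm y (1/ d)) ⟩
    d * (1/ d * y)   ≡⟨ *-assoc d (1/ d) y ⟨
    d * 1/ d * y     ≡⟨ cong (_* y) (*-inverseʳ d) ⟩
    1ℚ * y           ≡⟨ *-identityˡ y ⟩
    y                ≡⟨ dx≡y ⟨
    d * x            ∎)

  sumTo-cong : ∀ n {f g : ℕ → ℚ} → (∀ k → f k ≡ g k) → sumTo n f ≡ sumTo n g
  sumTo-cong n f≗g = cong (foldr _+_ 0ℚ) (map-cong f≗g (upTo (suc n)))

  sumTo-suc : ∀ n f → sumTo (suc n) f ≡ f 0 + sumTo n (f ∘ suc)
  sumTo-suc n f = cong (foldr _+_ 0ℚ)
    (trans (map-upTo f (2 ℕ.+ n)) (cong (f 0 ∷_) (sym (map-upTo (f ∘ suc) (suc n)))))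

  sumTo-sucʳ : ∀ n f → sumTo (suc n) f ≡ sumTo n f + f (suc n)
  sumTo-sucʳ zero    f = trans (cong (f 0 +_) (+-identityʳ (f 1))) (cong (_+ f 1) (sym (+-identityʳ (f 0))))
  sumTo-sucʳ (suc n) f = begin
    sumTo (2 ℕ.+ n) f                           ≡⟨ sumTo-suc (suc n) f ⟩
    f 0 + sumTo (suc n) (f ∘ suc)               ≡⟨ cong (f 0 +_) (sumTo-sucʳ n (f ∘ suc)) ⟩
    f 0 + (sumTo n (f ∘ suc) + f (2 ℕ.+ n))     ≡⟨ +-assoc (f 0) _ _ ⟨
    f 0 + sumTo n (f ∘ suc) + f (2 ℕ.+ n)       ≡⟨ cong (_+ f (2 ℕ.+ n)) (sumTo-suc n f) ⟨
    sumTo (suc n) f + f (2 ℕ.+ n)               ∎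

  sum-map-+ : ∀ (f g : ℕ → ℚ) xs →
    foldr _+_ 0ℚ (map (λ k → f k + g k) xs) ≡ foldr _+_ 0ℚ (map f xs) + foldr _+_ 0ℚ (map g xs)
  sum-map-+ f g []       = refl
  sum-map-+ f g (x ∷ xs) = trans (cong (f x + g x +_) (sum-map-+ f g xs)) (interchange (f x) (g x) _ _)
    where
    interchange : ∀ a b c d → a + b + (c + d) ≡ a + c + (b + d)
    interchange = solve 4 (λ a b c d → a :+ b :+ (c :+ d) := a :+ c :+ (b :+ d)) refl

  sum-map-* : ∀ c (f : ℕ → ℚ) xs → foldr _+_ 0ℚ (map (λ k → c * f k) xs) ≡ c * foldr _+_ 0ℚ (map f xs)
  sum-map-* c f []       = sym (*-zeroʳ c)
  sum-map-* c f (x ∷ xs) = trans (cong (c * f x +_) (sum-map-* c f xs)) (sym (*-distribˡ-+ c (f x) _))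

  -- pascal n g = (1 + E)ⁿ g, where E g = g ∘ suc is the shift.
  pascal : ℕ → (ℕ → ℚ) → ℕ → ℚ
  pascal zero    g m = g m
  pascal (suc n) g m = pascal n g m + pascal n g (suc m)

  pascal-shift : ∀ n g m → pascal n (g ∘ suc) m ≡ pascal n g (suc m)
  pascal-shift zero    g m = refl
  pascal-shift (suc n) g m = cong₂ _+_ (pascal-shift n g m) (pascal-shift n g (suc m))

  sumTo-pascal : ∀ n (g : ℕ → ℚ) →
    sumTo (suc n) (λ k → fromℕ (suc n C k) * g k) ≡
    sumTo n (λ k → fromℕ (n C k) * g k) + sumTo n (λ k → fromℕ (n C k) * g (suc k))
  sumTo-pascal n g = begin
    sumTo (suc n) (λ k → fromℕ (suc n C k) * g k)                 ≡⟨ sumTo-suc n (λ k → fromℕ (suc n C k) * g k) ⟩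
    a 0 + sumTo n (λ k → fromℕ (suc n C suc k) * g (suc k))       ≡⟨ cong (a 0 +_) (sumTo-cong n split) ⟩
    a 0 + sumTo n (λ k → a (suc k) + b k)                         ≡⟨ cong (a 0 +_) (sum-map-+ (a ∘ suc) b (upTo (suc n))) ⟩
    a 0 + (sumTo n (a ∘ suc) + sumTo n b)                         ≡⟨ +-assoc (a 0) _ _ ⟨
    a 0 + sumTo n (a ∘ suc) + sumTo n b                           ≡⟨ cong (_+ sumTo n b) (sumTo-suc n a) ⟨
    sumTo (suc n) a + sumTo n b                                   ≡⟨ cong (_+ sumTo n b) (sumTo-sucʳ n a) ⟩
    sumTo n a + a (suc n) + sumTo n b                             ≡⟨ cong (λ x → sumTo n a + x + sumTo n b) a[1+n]≡0 ⟩
    sumTo n a + 0ℚ + sumTo n b                                    ≡⟨ cong (_+ sumTo n b) (+-identityʳ (sumTo n a)) ⟩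
    sumTo n a + sumTo n b                                         ∎
    where
    a b : ℕ → ℚ
    a k = fromℕ (n C k) * g k
    b k = fromℕ (n C k) * g (suc k)
    split : ∀ k → fromℕ (suc n C suc k) * g (suc k) ≡ a (suc k) + b k
    split k = begin
      fromℕ (suc n C suc k) * g (suc k)                      ≡⟨ cong (λ c → fromℕ c * g (suc k)) pascal-rule ⟨
      fromℕ (n C suc k ℕ.+ n C k) * g (suc k)                ≡⟨ cong (_* g (suc k)) (fromℕ-+ (n C suc k) (n C k)) ⟩
      (fromℕ (n C suc k) + fromℕ (n C k)) * g (suc k)        ≡⟨ *-distribʳ-+ (g (suc k)) (fromℕ (n C suc k)) (fromℕ (n C k)) ⟩
      a (suc k) + b k                                        ∎
      where pascal-rule = trans (ℕ.+-comm (n C suc k) (n C k)) (nCk+nC[k+1]≡[n+1]C[k+1] n k)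
    a[1+n]≡0 : a (suc n) ≡ 0ℚ
    a[1+n]≡0 = trans (cong (λ c → fromℕ c * g (suc n)) (k>n⇒nCk≡0 (ℕ.n<1+n n))) (*-zeroˡ (g (suc n)))

  sumTo-binomial : ∀ n g → sumTo n (λ k → fromℕ (n C k) * g k) ≡ pascal n g 0
  sumTo-binomial zero    g = trans (+-identityʳ _) (*-identityˡ (g 0))
  sumTo-binomial (suc n) g = begin
    sumTo (suc n) (λ k → fromℕ (suc n C k) * g k)                           ≡⟨ sumTo-pascal n g ⟩
    sumTo n (λ k → fromℕ (n C k) * g k) + sumTo n (λ k → fromℕ (n C k) * g (suc k))
      ≡⟨ cong₂ _+_ (sumTo-binomial n g) (sumTo-binomial n (g ∘ suc)) ⟩
    pascal n g 0 + pascal n (g ∘ suc) 0                                      ≡⟨ cong (pascal n g 0 +_) (pascal-shift n g 0) ⟩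
    pascal n g 0 + pascal n g 1                                              ∎

  t : ℕ → ℚ
  t k = ((sign k ℤ.* ℤ.+ (2 ^ (2 ℕ.* k))) / D k) {{denNonZero k}}

  D*t≡sign*2^[2k] : ∀ k → fromℕ (D k) * t k ≡ fromℤ (sign k) * fromℕ (2 ^ (2 ℕ.* k))
  D*t≡sign*2^[2k] k = trans (fromℕq*[p/q]≡p _ (D k) {{denNonZero k}}) (fromℤ-* (sign k) _)

  2^[2+2m]≡4*2^[2m] : ∀ m → fromℕ (2 ^ (2 ℕ.* suc m)) ≡ fromℕ 4 * fromℕ (2 ^ (2 ℕ.* m))
  2^[2+2m]≡4*2^[2m] m = trans (cong fromℕ (trans (cong (2 ^_) (ℕ.*-suc 2 m)) (sym (ℕ.*-assoc 2 2 P))))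
                              (fromℕ-* 4 P)
    where P = 2 ^ (2 ℕ.* m)

  t-suc : ∀ m → fromℕ (3 ℕ.+ 2 ℕ.* m) * t (suc m) ≡ - (fromℕ (2 ℕ.+ 2 ℕ.* m) * t m)
  t-suc m = *-cancelˡ-≡ D₁ {{denNonZero (suc m)}} (begin
    D₁ * (a * t (suc m))                    ≡⟨ x∙yz≈y∙xz D₁ a (t (suc m)) ⟩
    a * (D₁ * t (suc m))                    ≡⟨ cong (a *_) (D*t≡sign*2^[2k] (suc m)) ⟩
    a * (fromℤ (sign (suc m)) * fromℕ (2 ^ (2 ℕ.* suc m)))
      ≡⟨ cong₂ (λ s p → a * (s * p)) (fromℤ-neg (sign m)) (2^[2+2m]≡4*2^[2m] m) ⟩
    a * (- σ * (fromℕ 4 * P))               ≡⟨ regroup a σ P (fromℕ 4) ⟩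
    - (fromℕ 4 * a * (σ * P))               ≡⟨ cong (λ x → - (fromℕ 4 * a * x)) (D*t≡sign*2^[2k] m) ⟨
    - (fromℕ 4 * a * (D₀ * t m))            ≡⟨ cong -_ (*-assoc (fromℕ 4 * a) D₀ (t m)) ⟨
    - (fromℕ 4 * a * D₀ * t m)              ≡⟨ cong (λ x → - (x * t m)) D-sucℚ ⟨
    - (b * D₁ * t m)                        ≡⟨ -[yx*z]≡x*-[y*z] D₁ b (t m) ⟩
    D₁ * - (b * t m)                        ∎)
    where
    D₀ = fromℕ (D m)
    D₁ = fromℕ (D (suc m))
    a = fromℕ (3 ℕ.+ 2 ℕ.* m)
    b = fromℕ (2 ℕ.+ 2 ℕ.* m)
    σ = fromℤ (sign m)
    P = fromℕ (2 ^ (2 ℕ.* m))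
    D-sucℚ : b * D₁ ≡ fromℕ 4 * a * D₀
    D-sucℚ = begin
      b * D₁                                       ≡⟨ fromℕ-* (2 ℕ.+ 2 ℕ.* m) (D (suc m)) ⟨
      fromℕ ((2 ℕ.+ 2 ℕ.* m) ℕ.* D (suc m))        ≡⟨ cong fromℕ (D-suc m) ⟩
      fromℕ (4 ℕ.* ((3 ℕ.+ 2 ℕ.* m) ℕ.* D m))      ≡⟨ fromℕ-* 4 ((3 ℕ.+ 2 ℕ.* m) ℕ.* D m) ⟩
      fromℕ 4 * fromℕ ((3 ℕ.+ 2 ℕ.* m) ℕ.* D m)    ≡⟨ cong (fromℕ 4 *_) (fromℕ-* (3 ℕ.+ 2 ℕ.* m) (D m)) ⟩
      fromℕ 4 * (a * D₀)                           ≡⟨ *-assoc (fromℕ 4) a D₀ ⟨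
      fromℕ 4 * a * D₀                             ∎
    -[yx*z]≡x*-[y*z] : ∀ x y z → - (y * x * z) ≡ x * - (y * z)
    -[yx*z]≡x*-[y*z] = solve 3 (λ x y z → :- (y :* x :* z) := x :* (:- (y :* z))) refl
    regroup : ∀ a σ P c → a * (- σ * (c * P)) ≡ - (c * a * (σ * P))
    regroup = solve 4 (λ a σ P c → a :* (:- σ :* (c :* P)) := :- (c :* a :* (σ :* P))) refl

  u : ℕ → ℕ → ℚ
  u n = pascal n t

  u-sucʳ : ∀ n m → fromℕ (3 ℕ.+ 2 ℕ.* (n ℕ.+ m)) * u n (suc m) ≡ - (fromℕ (2 ℕ.+ 2 ℕ.* m) * u n m)
  u-sucˡ : ∀ n m → fromℕ (3 ℕ.+ 2 ℕ.* (n ℕ.+ m)) * u (suc n) m ≡ fromℕ (1 ℕ.+ 2 ℕ.* n) * u n m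

  u-sucʳ zero    m = t-suc m
  -- After multiplying by c, both sides become -(2n+1)(2m+2) u n m by the claims for n.
  u-sucʳ (suc n) m = *-cancelˡ-≡ c (begin
    c * (c′ * u (suc n) (suc m))    ≡⟨ cong (λ x → c * (fromℕ (3 ℕ.+ 2 ℕ.* x) * u (suc n) (suc m))) (ℕ.+-suc n m) ⟨
    c * (c″ * u (suc n) (suc m))    ≡⟨ cong (c *_) (u-sucˡ n (suc m)) ⟩
    c * (a * u n (suc m))           ≡⟨ x∙yz≈y∙xz c a (u n (suc m)) ⟩
    a * (c * u n (suc m))           ≡⟨ cong (a *_) (u-sucʳ n m) ⟩
    a * - (b * u n m)               ≡⟨ regroup a b (u n m) ⟩
    - (b * (a * u n m))             ≡⟨ cong (λ x → - (b * x)) (u-sucˡ n m) ⟨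
    - (b * (c * u (suc n) m))       ≡⟨ regroup′ c b (u (suc n) m) ⟩
    c * - (b * u (suc n) m)         ∎)
    where
    a = fromℕ (1 ℕ.+ 2 ℕ.* n)
    b = fromℕ (2 ℕ.+ 2 ℕ.* m)
    c = fromℕ (3 ℕ.+ 2 ℕ.* (n ℕ.+ m))
    c′ = fromℕ (3 ℕ.+ 2 ℕ.* (suc n ℕ.+ m))
    c″ = fromℕ (3 ℕ.+ 2 ℕ.* (n ℕ.+ suc m))
    regroup : ∀ a b x → a * - (b * x) ≡ - (b * (a * x))
    regroup = solve 3 (λ a b x → a :* (:- (b :* x)) := :- (b :* (a :* x))) refl
    regroup′ : ∀ c b x → - (b * (c * x)) ≡ c * - (b * x)
    regroup′ = solve 3 (λ c b x → :- (b :* (c :* x)) := c :* (:- (b :* x))) refl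

  u-sucˡ n m = begin
    c * (u n m + u n (suc m))         ≡⟨ *-distribˡ-+ c (u n m) (u n (suc m)) ⟩
    c * u n m + c * u n (suc m)       ≡⟨ cong (c * u n m +_) (u-sucʳ n m) ⟩
    c * u n m + - (b * u n m)         ≡⟨ cong (λ x → x * u n m + - (b * u n m)) c≡a+b ⟩
    (a + b) * u n m + - (b * u n m)   ≡⟨ cancel a b (u n m) ⟩
    a * u n m                         ∎
    where
    a = fromℕ (1 ℕ.+ 2 ℕ.* n)
    b = fromℕ (2 ℕ.+ 2 ℕ.* m)
    c = fromℕ (3 ℕ.+ 2 ℕ.* (n ℕ.+ m))
    c≡a+b : c ≡ a + b
    c≡a+b = trans (cong fromℕ (split n m)) (fromℕ-+ (1 ℕ.+ 2 ℕ.* n) (2 ℕ.+ 2 ℕ.* m))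
      where split : ∀ n m → 3 ℕ.+ 2 ℕ.* (n ℕ.+ m) ≡ (1 ℕ.+ 2 ℕ.* n) ℕ.+ (2 ℕ.+ 2 ℕ.* m)
            split = ℕ-Solver.solve-∀
    cancel : ∀ a b x → (a + b) * x + - (b * x) ≡ a * x
    cancel = solve 3 (λ a b x → (a :+ b) :* x :+ :- (b :* x) := a :* x) refl

  [1+2n]*u[n,0]≡1 : ∀ n → fromℕ (1 ℕ.+ 2 ℕ.* n) * u n 0 ≡ 1ℚ
  [1+2n]*u[n,0]≡1 zero    = refl
  [1+2n]*u[n,0]≡1 (suc n) = begin
    fromℕ (1 ℕ.+ 2 ℕ.* suc n) * u (suc n) 0          ≡⟨ cong (λ x → fromℕ x * u (suc n) 0) (odd n) ⟩
    fromℕ (3 ℕ.+ 2 ℕ.* (n ℕ.+ 0)) * u (suc n) 0      ≡⟨ u-sucˡ n 0 ⟩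
    fromℕ (1 ℕ.+ 2 ℕ.* n) * u n 0                    ≡⟨ [1+2n]*u[n,0]≡1 n ⟩
    1ℚ                                               ∎
    where odd : ∀ n → 1 ℕ.+ 2 ℕ.* suc n ≡ 3 ℕ.+ 2 ℕ.* (n ℕ.+ 0)
          odd = ℕ-Solver.solve-∀

  term₁≡Cnk*t : ∀ n k → term₁ n k ≡ fromℕ (n C k) * t k
  term₁≡Cnk*t n k = /-unique _ (D k) {{denNonZero k}} (begin
    fromℕ (D k) * (B * t k)          ≡⟨ x∙yz≈y∙xz (fromℕ (D k)) B (t k) ⟩
    B * (fromℕ (D k) * t k)          ≡⟨ cong (B *_) (D*t≡sign*2^[2k] k) ⟩
    B * (σ * P)                      ≡⟨ x∙yz≈y∙xz B σ P ⟩
    σ * (B * P)                      ≡⟨ cong (σ *_) (*-comm B P) ⟩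
    σ * (P * B)                      ≡⟨ cong (σ *_) (fromℕ-* (2 ^ (2 ℕ.* k)) (n C k)) ⟨
    σ * fromℕ (2 ^ (2 ℕ.* k) ℕ.* (n C k))  ≡⟨ fromℤ-* (sign k) _ ⟨
    fromℤ (sign k ℤ.* ℤ.+ (2 ^ (2 ℕ.* k) ℕ.* (n C k))) ∎)
    where
    B = fromℕ (n C k)
    σ = fromℤ (sign k)
    P = fromℕ (2 ^ (2 ℕ.* k))

  term₂-suc : ∀ n k → term₂ (suc n) (suc k) ≡ - fromℕ (suc n) * (fromℕ (n C k) * t (suc k))
  term₂-suc n k = /-unique _ (D (suc k)) {{denNonZero (suc k)}} (begin
    D₁ * (- N * (B * t (suc k)))     ≡⟨ x∙yz≈y∙xz D₁ (- N) (B * t (suc k)) ⟩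
    - N * (D₁ * (B * t (suc k)))     ≡⟨ cong (- N *_) (x∙yz≈y∙xz D₁ B (t (suc k))) ⟩
    - N * (B * (D₁ * t (suc k)))     ≡⟨ cong (λ x → - N * (B * x)) (D*t≡sign*2^[2k] (suc k)) ⟩
    - N * (B * (σ * P))              ≡⟨ regroup N B σ P ⟩
    - σ * (P * (N * B))              ≡⟨ cong (- σ *_) casts ⟨
    - σ * fromℕ X                    ≡⟨ cong (_* fromℕ X) (fromℤ-neg (sign (suc k))) ⟨
    fromℤ (sign (suc (suc k))) * fromℕ X  ≡⟨ fromℤ-* (sign (suc (suc k))) (ℤ.+ X) ⟨
    fromℤ (sign (suc (suc k)) ℤ.* ℤ.+ X)  ∎)
    where
    D₁ = fromℕ (D (suc k))
    N = fromℕ (suc n)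
    B = fromℕ (n C k)
    σ = fromℤ (sign (suc k))
    P = fromℕ (2 ^ (2 ℕ.* suc k))
    X = 2 ^ (2 ℕ.* suc k) ℕ.* suc k ℕ.* (suc n C suc k)
    casts : fromℕ X ≡ P * (N * B)
    casts = begin
      fromℕ X                                                    ≡⟨ cong fromℕ (ℕ.*-assoc (2 ^ (2 ℕ.* suc k)) (suc k) _) ⟩
      fromℕ (2 ^ (2 ℕ.* suc k) ℕ.* (suc k ℕ.* (suc n C suc k))) ≡⟨ cong (λ x → fromℕ (2 ^ (2 ℕ.* suc k) ℕ.* x)) ([1+k]*[1+n]C[1+k]≡[1+n]*nCk n k) ⟩
      fromℕ (2 ^ (2 ℕ.* suc k) ℕ.* (suc n ℕ.* (n C k)))         ≡⟨ fromℕ-* (2 ^ (2 ℕ.* suc k)) _ ⟩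
      P * fromℕ (suc n ℕ.* (n C k))                              ≡⟨ cong (P *_) (fromℕ-* (suc n) (n C k)) ⟩
      P * (N * B)                                                ∎
    regroup : ∀ a b c d → - a * (b * (c * d)) ≡ - c * (d * (a * b))
    regroup = solve 4 (λ a b c d → :- a :* (b :* (c :* d)) := :- c :* (d :* (a :* b))) refl

  first-identity : ∀ n → sumTo n (term₁ n) ≡ rhs₁ n
  first-identity n = begin
    sumTo n (term₁ n)                      ≡⟨ sumTo-cong n (term₁≡Cnk*t n) ⟩
    sumTo n (λ k → fromℕ (n C k) * t k)    ≡⟨ sumTo-binomial n t ⟩
    u n 0                                  ≡⟨ ÷-unique (fromℕ (2 ℕ.* n ℕ.+ 1)) {{oddNonZero n}} [2n+1]*u[n,0]≡1 ⟨
    rhs₁ n                                 ∎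
    where
    [2n+1]*u[n,0]≡1 : fromℕ (2 ℕ.* n ℕ.+ 1) * u n 0 ≡ 1ℚ
    [2n+1]*u[n,0]≡1 = trans (cong (λ x → fromℕ x * u n 0) (ℕ.+-comm (2 ℕ.* n) 1)) ([1+2n]*u[n,0]≡1 n)

  den₂-suc : ∀ n → den₂ (suc n) ≡ fromℕ (3 ℕ.+ 2 ℕ.* n) * fromℕ (1 ℕ.+ 2 ℕ.* n)
  den₂-suc n = trans (fromℤ-* (ℤ.+ (2 ℕ.* suc n ℕ.+ 1)) _)
    (cong₂ (λ x y → fromℕ x * fromℕ y) (outer n) (ℕ.+-suc n (n ℕ.+ 0)))
    where outer : ∀ n → 2 ℕ.* suc n ℕ.+ 1 ≡ 3 ℕ.+ 2 ℕ.* n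
          outer = ℕ-Solver.solve-∀

  second-identity : ∀ n → sumTo n (term₂ n) ≡ rhs₂ n
  second-identity zero    = refl
  second-identity (suc n) = begin
    sumTo (suc n) (term₂ (suc n))                         ≡⟨ sumTo-suc n (term₂ (suc n)) ⟩
    0ℚ + sumTo n (term₂ (suc n) ∘ suc)                    ≡⟨ +-identityˡ _ ⟩
    sumTo n (term₂ (suc n) ∘ suc)                         ≡⟨ sumTo-cong n (term₂-suc n) ⟩
    sumTo n (λ k → - N * (fromℕ (n C k) * t (suc k)))
      ≡⟨ sum-map-* (- N) (λ k → fromℕ (n C k) * t (suc k)) (upTo (suc n)) ⟩
    - N * sumTo n (λ k → fromℕ (n C k) * t (suc k))       ≡⟨ cong (- N *_) (sumTo-binomial n (t ∘ suc)) ⟩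
    - N * pascal n (t ∘ suc) 0                            ≡⟨ cong (- N *_) (pascal-shift n t 0) ⟩
    - N * u n 1                                           ≡⟨ ÷-unique (den₂ (suc n)) {{den₂NonZero (suc n)}} den₂*[-N*u[n,1]]≡2N ⟨
    rhs₂ (suc n)                                          ∎
    where
    N = fromℕ (suc n)
    a = fromℕ (1 ℕ.+ 2 ℕ.* n)
    c = fromℕ (3 ℕ.+ 2 ℕ.* n)
    c*u[n,1] : c * u n 1 ≡ - (fromℕ 2 * u n 0)
    c*u[n,1] = subst (λ x → fromℕ (3 ℕ.+ 2 ℕ.* x) * u n 1 ≡ - (fromℕ 2 * u n 0)) (ℕ.+-identityʳ n) (u-sucʳ n 0)
    den₂*[-N*u[n,1]]≡2N : den₂ (suc n) * (- N * u n 1) ≡ fromℕ (2 ℕ.* suc n)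
    den₂*[-N*u[n,1]]≡2N = begin
      den₂ (suc n) * (- N * u n 1)      ≡⟨ cong (_* (- N * u n 1)) (den₂-suc n) ⟩
      c * a * (- N * u n 1)             ≡⟨ regroup c a N (u n 1) ⟩
      - N * a * (c * u n 1)             ≡⟨ cong (- N * a *_) c*u[n,1] ⟩
      - N * a * - (fromℕ 2 * u n 0)     ≡⟨ regroup′ N a (fromℕ 2) (u n 0) ⟩
      fromℕ 2 * N * (a * u n 0)         ≡⟨ cong (fromℕ 2 * N *_) ([1+2n]*u[n,0]≡1 n) ⟩
      fromℕ 2 * N * 1ℚ                  ≡⟨ *-identityʳ (fromℕ 2 * N) ⟩
      fromℕ 2 * N                       ≡⟨ fromℕ-* 2 (suc n) ⟨
      fromℕ (2 ℕ.* suc n)               ∎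
      where
      regroup : ∀ c a N x → c * a * (- N * x) ≡ - N * a * (c * x)
      regroup = solve 4 (λ c a N x → c :* a :* (:- N :* x) := :- N :* a :* (c :* x)) refl
      regroup′ : ∀ N a b x → - N * a * - (b * x) ≡ b * N * (a * x)
      regroup′ = solve 4 (λ N a b x → :- N :* a :* (:- (b :* x)) := b :* N :* (a :* x)) refl

corollary28 : (n : ℕ) →
    (sumTo n (term₁ n) ≡ rhs₁ n) ×
    (sumTo n (term₂ n) ≡ rhs₂ n)
corollary28 n = first-identity n , second-identity n
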